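{- Let $\mathbb{K}$ be a field, let $A_1,\dots,A_k\in M_n(\mathbb{K})$, and let $S\subset\mathbb{K}$ be a finite set. Let $A_\alpha=\sum_{i\in[k]}\alpha_iA_i$ and $A_\beta=\sum_{i\in[k]}\beta_iA_i$, where the $\alpha_i$ and $\beta_i$ are picked independently and uniformly at random from $S$. If $\{A_i\}_{i\in[k]}$ is not a commuting family, then $A_\alpha$ and $A_\beta$ commute with probability at most $\frac{2}{|S|}$. -}

module Defs where

open import Level using (Level; _⊔_)
open import Data.Nat using (ℕ)
open import Data.Fin using (Fin)
open import Data.Product using (_×_; _,_; Σ)
open import Relation.Nullary using (¬_)
open import Relation.Binary.Bundles using (Setoid)
open import Algebra.Bundles using (CommutativeRing)
import Algebra.Properties.CommutativeMonoid.Sum as SumProps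

record Field (c ℓ : Level) : Set (Level.suc (c ⊔ ℓ)) where
  field
    commutativeRing : CommutativeRing c ℓ
  open CommutativeRing commutativeRing public
  field
    1≉0     : ¬ (1# ≈ 0#)
    inverse : ∀ x → ¬ (x ≈ 0#) → Σ Carrier λ y → (x * y) ≈ 1#

module FieldMat {c ℓ : Level} (F : Field c ℓ) where
  open Field F public
  open SumProps +-commutativeMonoid using (sum)

  Mat : ℕ → Set c
  Mat n = Fin n → Fin n → Carrier

  _⊗_ : ∀ {n} → Mat n → Mat n → Mat n
  (A ⊗ B) r s = sum (λ t → A r t * B t s)

  _≋_ : ∀ {n} → Mat n → Mat n → Set ℓ
  A ≋ B = ∀ r s → A r s ≈ B r s

  Commute : ∀ {n} → Mat n → Mat n → Set ℓ
  Commute A B = (A ⊗ B) ≋ (B ⊗ A)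

  lincomb : ∀ {k n} → (Fin k → Carrier) → (Fin k → Mat n) → Mat n
  lincomb α As r s = sum (λ i → α i * As i r s)

  CoeffPairSetoid : ℕ → Setoid c ℓ
  CoeffPairSetoid k = record
    { Carrier = (Fin k → Carrier) × (Fin k → Carrier)
    ; _≈_ = λ { (α , β) (α' , β') → (∀ i → α i ≈ α' i) × (∀ i → β i ≈ β' i) }
    ; isEquivalence = record
      { refl  = (λ i → refl) , (λ i → refl)
      ; sym   = λ { (p , q) → (λ i → sym (p i)) , (λ i → sym (q i)) }
      ; trans = λ { (p , q) (p' , q') → (λ i → trans (p i) (p' i)) , (λ i → trans (q i) (q' i)) }
      }
    }

-- Fix an entry (r, s) at which Aᵢ₀ and Aⱼ₀ do not commute. The (r, s) entry of
-- [A_α, A_β] is the bilinear form Σⱼ βⱼ wⱼ(α) with wⱼ(α) = Σᵢ αᵢ [Aᵢ, Aⱼ]ᵣₛ, whose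
-- coefficient at (i₀, j₀) is nonzero. A commuting pair (α, β) together with an
-- extra value b ∈ S is coded injectively in {0, 1} × Sᵏ × Sᵏ: if wⱼ₀(α) ≠ 0 the
-- vanishing of the form determines βⱼ₀ from the rest, so βⱼ₀ is replaced by b;
-- if wⱼ₀(α) = 0, this linear condition on α determines αᵢ₀, which is replaced by b.

module Submission where

open import Defs
open import Data.Nat using (ℕ)
import Data.Nat as N
open import Data.Fin using (Fin)
open import Data.List using (List; length)
open import Data.Product using (_×_; _,_; ∃₂)
open import Relation.Nullary using (¬_)
open import Data.List.Relation.Unary.All using (All)
import Data.List.Membership.Setoid as SetoidMembership
import Data.List.Relation.Unary.Unique.Setoid as SetoidUnique

open import Level using (_⊔_)
open import Function using (_∘_; const)
open import Data.Nat.Properties using (_≤?_; ^-distribˡ-+-*; +-identityʳ)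
open import Data.Fin using (zero; suc; _≟_; punchIn; combine; remQuot; funToFin; finToFun)
open import Data.Fin.Properties
  using (¬∀⟶∃¬; punchInᵢ≢i; combine-injective; combine-remQuot; finToFun-funToFin; injective⇒≤)
open import Data.Product using (∃; proj₁; uncurry)
open import Data.List using ([]; _∷_; lookup)
import Data.List.Relation.Unary.All as All
open import Data.List.Relation.Unary.AllPairs using (_∷_)
open import Data.List.Relation.Unary.Any using (index)
open import Data.List.Membership.Propositional.Properties using (∈-lookup)
import Data.List.Membership.Setoid.Properties as SetoidMembershipProps
open import Data.Vec.Functional using (updateAt; removeAt)
open import Data.Vec.Functional.Properties using (updateAt-updates; updateAt-minimal)
open import Relation.Binary.Bundles using (Setoid)
import Relation.Binary.PropositionalEquality as ≡
open ≡ using (_≡_; _≢_; _≗_)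
import Relation.Binary.Reasoning.Setoid as SetoidReasoning
open import Relation.Nullary using (Dec; yes; no)
open import Relation.Nullary.Decidable using (decidable-stable; ¬¬-excluded-middle)
open import Relation.Nullary.Negation using (contradiction)
import Algebra.Properties.CommutativeMonoid.Sum as CommutativeMonoidSum
import Algebra.Properties.Semiring.Sum as SemiringSum
import Algebra.Properties.CommutativeSemigroup as CommutativeSemigroupProps
import Algebra.Properties.Group as GroupProps
import Algebra.Properties.Ring as RingProps

¬¬-∀-Fin : ∀ {n p} {P : Fin n → Set p} → (∀ i → ¬ ¬ P i) → ¬ ¬ (∀ i → P i)
¬¬-∀-Fin {N.zero} h ¬∀ = ¬∀ λ ()
¬¬-∀-Fin {N.suc n} {P = P} h ¬∀ =
  h zero λ p₀ → ¬¬-∀-Fin {P = P ∘ suc} (h ∘ suc) λ p₊ → ¬∀ λ { zero → p₀ ; (suc i) → p₊ i }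

¬∀⇒¬¬∃¬ : ∀ {n p} {P : Fin n → Set p} → ¬ (∀ i → P i) → ¬ ¬ (∃ λ i → ¬ P i)
¬∀⇒¬¬∃¬ {n} {P = P} ¬∀ ¬∃ =
  ¬¬-∀-Fin (λ i → ¬¬-excluded-middle {A = P i}) λ P? → ¬∃ (¬∀⟶∃¬ n P P? ¬∀)

¬¬-All : ∀ {a p} {A : Set a} {P : A → Set p} → (∀ x → ¬ ¬ P x) → ∀ xs → ¬ ¬ All P xs
¬¬-All h []       ¬all = ¬all All.[]
¬¬-All h (x ∷ xs) ¬all = h x λ px → ¬¬-All h xs λ pxs → ¬all (px All.∷ pxs)

module _ {a ℓ} (X : Setoid a ℓ) where
  open Setoid X using (Carrier; _≈_; sym)

  lookup-injective : ∀ {xs} → SetoidUnique.Unique X xs → ∀ i j → lookup xs i ≈ lookup xs j → i ≡ j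
  lookup-injective (_ ∷ _)      zero    zero    _ = ≡.refl
  lookup-injective (x≉xs ∷ _)   zero    (suc j) e = contradiction e (All.lookup x≉xs (∈-lookup j))
  lookup-injective (x≉xs ∷ _)   (suc i) zero    e = contradiction (sym e) (All.lookup x≉xs (∈-lookup i))
  lookup-injective (_ ∷ unique) (suc i) (suc j) e = ≡.cong suc (lookup-injective unique i j e)

  unique-coding⇒≤ : ∀ {p m N} {Q : Carrier → Set p} {xs} →
    SetoidUnique.Unique X xs → All Q xs →
    (code : ∀ {x} → Q x → Fin m → Fin N) →
    (∀ {x y} (qx : Q x) (qy : Q y) {b c} → code qx b ≡ code qy c → x ≈ y × b ≡ c) →
    length xs N.* m N.≤ N
  unique-coding⇒≤ {m = m} {xs = xs} unique all code code-injective = injective⇒≤ coding-injective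
    where
    codeAt : Fin (length xs) × Fin m → Fin _
    codeAt (i , b) = code (All.lookup all (∈-lookup i)) b

    coding : Fin (length xs N.* m) → Fin _
    coding = codeAt ∘ remQuot m

    remQuot-injective : ∀ {u v} → remQuot {length xs} m u ≡ remQuot m v → u ≡ v
    remQuot-injective {u} {v} e =
      ≡.trans (≡.sym (combine-remQuot {length xs} m u)) (≡.trans (≡.cong (uncurry combine) e) (combine-remQuot {length xs} m v))

    codeAt-injective : ∀ {ib jc} → codeAt ib ≡ codeAt jc → ib ≡ jc
    codeAt-injective {i , b} {j , c} e =
      let xᵢ≈xⱼ , b≡c = code-injective (All.lookup all (∈-lookup i)) (All.lookup all (∈-lookup j)) e
      in ≡.cong₂ _,_ (lookup-injective unique i j xᵢ≈xⱼ) b≡c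

    coding-injective : ∀ {u v} → coding u ≡ coding v → u ≡ v
    coding-injective = remQuot-injective ∘ codeAt-injective

funToFin-injective : ∀ {k m} {f g : Fin k → Fin m} → funToFin f ≡ funToFin g → f ≗ g
funToFin-injective {f = f} {g} e i =
  ≡.trans (≡.sym (finToFun-funToFin f i)) (≡.trans (≡.cong (λ z → finToFun z i) e) (finToFun-funToFin g i))

updateAt-const-injective : ∀ {a} {A : Set a} {k} {u v : Fin k → A} {q b c} →
  updateAt u q (const b) ≗ updateAt v q (const c) → b ≡ c × (∀ i → i ≢ q → u i ≡ v i)
updateAt-const-injective {u = u} {v} {q} e =
    ≡.trans (≡.sym (updateAt-updates q u)) (≡.trans (e q) (updateAt-updates q v))
  , λ i i≢q → ≡.trans (≡.sym (updateAt-minimal i q u i≢q)) (≡.trans (e i) (updateAt-minimal i q v i≢q))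

m^k*m^k≡m^[2*k] : ∀ m k → m N.^ k N.* m N.^ k ≡ m N.^ (2 N.* k)
m^k*m^k≡m^[2*k] m k =
  ≡.trans (≡.cong (λ e → m N.^ k N.* m N.^ e) (≡.sym (+-identityʳ k))) (≡.sym (^-distribˡ-+-* m k (k N.+ 0)))

opaque
  encode : ∀ {k m} → Fin 2 × (Fin k → Fin m) × (Fin k → Fin m) → Fin (2 N.* (m N.^ k N.* m N.^ k))
  encode (t , u , v) = combine t (combine (funToFin u) (funToFin v))

  encode-injective : ∀ {k m t t'} {u v u' v' : Fin k → Fin m} →
    encode (t , u , v) ≡ encode (t' , u' , v') → t ≡ t' × u ≗ u' × v ≗ v'
  encode-injective {t = t} {t'} {u} {v} {u'} {v'} e =
    let t≡t' , e' = combine-injective t _ t' _ e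
        u≡u' , v≡v' = combine-injective (funToFin u) (funToFin v) (funToFin u') (funToFin v') e'
    in t≡t' , funToFin-injective u≡u' , funToFin-injective v≡v'

module _ {c ℓ} (F : Field c ℓ) where
  open FieldMat F hiding (zero)
  open CommutativeMonoidSum +-commutativeMonoid using (sum; sum-cong-≋; sum-remove; ∑-comm; ∑-distrib-+)
  open SemiringSum semiring using (*-distribˡ-sum; *-distribʳ-sum)
  open CommutativeSemigroupProps *-commutativeSemigroup using (x∙yz≈y∙xz)
  open GroupProps +-group using (∙-cancelʳ; //-cong₂; x∙y⁻¹≈ε⇒x≈y)
  open RingProps ring using (-1*x≈-x; -‿distribʳ-*)
  open SetoidReasoning setoid

  *-cancelʳ-≉0 : ∀ {x y z} → ¬ z ≈ 0# → x * z ≈ y * z → x ≈ y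
  *-cancelʳ-≉0 {x} {y} {z} z≉0 xz≈yz = let z⁻¹ , zz⁻¹≈1 = inverse z z≉0 in begin
    x              ≈⟨ *-identityʳ x ⟨
    x * 1#         ≈⟨ *-congˡ zz⁻¹≈1 ⟨
    x * (z * z⁻¹)  ≈⟨ *-assoc x z z⁻¹ ⟨
    x * z * z⁻¹    ≈⟨ *-congʳ xz≈yz ⟩
    y * z * z⁻¹    ≈⟨ *-assoc y z z⁻¹ ⟩
    y * (z * z⁻¹)  ≈⟨ *-congˡ zz⁻¹≈1 ⟩
    y * 1#         ≈⟨ *-identityʳ y ⟩
    y              ∎

  Vector : ℕ → Set c
  Vector k = Fin k → Carrier

  infix 4 _≈ᵥ_
  _≈ᵥ_ : ∀ {k} → Vector k → Vector k → Set ℓ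
  x ≈ᵥ y = ∀ i → x i ≈ y i

  AgreeOff : ∀ {k} → Fin k → Vector k → Vector k → Set ℓ
  AgreeOff q x y = ∀ i → i ≢ q → x i ≈ y i

  infixl 7 _·_
  _·_ : ∀ {k} → Vector k → Vector k → Carrier
  x · y = sum λ i → x i * y i

  ·-cong : ∀ {k} {x x' y y' : Vector k} → x ≈ᵥ x' → y ≈ᵥ y' → x · y ≈ x' · y'
  ·-cong x≈x' y≈y' = sum-cong-≋ λ i → *-cong (x≈x' i) (y≈y' i)

  ·-distribˡ-‿ : ∀ {k} (x u v : Vector k) → x · (λ i → u i - v i) ≈ x · u - x · v
  ·-distribˡ-‿ x u v = begin
    x · (λ i → u i - v i)                  ≈⟨ sum-cong-≋ (λ i → trans (distribˡ (x i) (u i) (- v i)) (+-congˡ (sym (-‿distribʳ-* (x i) (v i))))) ⟩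
    sum (λ i → x i * u i - x i * v i)      ≈⟨ ∑-distrib-+ (λ i → x i * u i) (λ i → - (x i * v i)) ⟩
    x · u + sum (λ i → - (x i * v i))      ≈⟨ +-congˡ (sum-cong-≋ λ i → -1*x≈-x (x i * v i)) ⟨
    x · u + sum (λ i → - 1# * (x i * v i)) ≈⟨ +-congˡ (*-distribˡ-sum (- 1#) (λ i → x i * v i)) ⟨
    x · u + - 1# * (x · v)                 ≈⟨ +-congˡ (-1*x≈-x (x · v)) ⟩
    x · u - x · v                          ∎

  ·-swap : ∀ {k l} (x : Vector k) (y : Vector l) (T : Fin k → Fin l → Carrier) →
    x · (λ i → y · T i) ≈ y · (λ j → x · λ i → T i j)
  ·-swap x y T = begin
    sum (λ i → x i * sum λ j → y j * T i j)        ≈⟨ sum-cong-≋ (λ i → *-distribˡ-sum (x i) λ j → y j * T i j) ⟩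
    sum (λ i → sum λ j → x i * (y j * T i j))      ≈⟨ ∑-comm (λ i j → x i * (y j * T i j)) ⟩
    sum (λ j → sum λ i → x i * (y j * T i j))      ≈⟨ sum-cong-≋ (λ j → sum-cong-≋ λ i → x∙yz≈y∙xz (x i) (y j) (T i j)) ⟩
    sum (λ j → sum λ i → y j * (x i * T i j))      ≈⟨ sum-cong-≋ (λ j → *-distribˡ-sum (y j) λ i → x i * T i j) ⟨
    sum (λ j → y j * sum λ i → x i * T i j)        ∎

  ·-zero-unique : ∀ {k} {q : Fin k} {w x y : Vector k} → ¬ w q ≈ 0# → AgreeOff q x y →
    x · w ≈ 0# → y · w ≈ 0# → x ≈ᵥ y
  ·-zero-unique {N.suc k} {q} {w} {x} {y} w≉0 x≈y x·w≈0 y·w≈0 i with i ≟ q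
  ... | no i≢q = x≈y i i≢q
  ... | yes ≡.refl = *-cancelʳ-≉0 w≉0 (∙-cancelʳ rest _ _ (begin
    x q * w q + rest                                ≈⟨ +-congˡ (sum-cong-≋ λ j → *-congʳ (x≈y (punchIn q j) (punchInᵢ≢i q j))) ⟨
    x q * w q + sum (removeAt (λ j → x j * w j) q)  ≈⟨ sum-remove (λ j → x j * w j) ⟨
    x · w                                           ≈⟨ trans x·w≈0 (sym y·w≈0) ⟩
    y · w                                           ≈⟨ sum-remove (λ j → y j * w j) ⟩
    y q * w q + rest                                ∎))
    where
    rest = sum (removeAt (λ j → y j * w j) q)

  [_,_] : ∀ {n} → Mat n → Mat n → Mat n
  [ A , B ] r s = (A ⊗ B) r s - (B ⊗ A) r s

  Commute⇒[,]≈0 : ∀ {n} {A B : Mat n} → Commute A B → ∀ r s → [ A , B ] r s ≈ 0#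
  Commute⇒[,]≈0 AB≋BA r s = trans (+-congʳ (AB≋BA r s)) (-‿inverseʳ _)

  [,]≈0⇒commuteAt : ∀ {n} {A B : Mat n} {r s} → [ A , B ] r s ≈ 0# → (A ⊗ B) r s ≈ (B ⊗ A) r s
  [,]≈0⇒commuteAt = x∙y⁻¹≈ε⇒x≈y _ _

  lincomb-⊗ˡ : ∀ {k n} (x : Vector k) (M : Fin k → Mat n) (B : Mat n) r s →
    (lincomb x M ⊗ B) r s ≈ x · λ i → (M i ⊗ B) r s
  lincomb-⊗ˡ x M B r s = begin
    sum (λ t → sum (λ i → x i * M i r t) * B t s)    ≈⟨ sum-cong-≋ (λ t → *-distribʳ-sum (B t s) λ i → x i * M i r t) ⟩
    sum (λ t → sum λ i → x i * M i r t * B t s)      ≈⟨ ∑-comm (λ t i → x i * M i r t * B t s) ⟩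
    sum (λ i → sum λ t → x i * M i r t * B t s)      ≈⟨ sum-cong-≋ (λ i → sum-cong-≋ λ t → *-assoc (x i) (M i r t) (B t s)) ⟩
    sum (λ i → sum λ t → x i * (M i r t * B t s))    ≈⟨ sum-cong-≋ (λ i → *-distribˡ-sum (x i) λ t → M i r t * B t s) ⟨
    sum (λ i → x i * (M i ⊗ B) r s)                  ∎

  lincomb-⊗ʳ : ∀ {k n} (A : Mat n) (y : Vector k) (M : Fin k → Mat n) r s →
    (A ⊗ lincomb y M) r s ≈ y · λ j → (A ⊗ M j) r s
  lincomb-⊗ʳ A y M r s = begin
    sum (λ t → A r t * sum λ j → y j * M j t s)      ≈⟨ sum-cong-≋ (λ t → *-distribˡ-sum (A r t) λ j → y j * M j t s) ⟩
    sum (λ t → sum λ j → A r t * (y j * M j t s))    ≈⟨ ∑-comm (λ t j → A r t * (y j * M j t s)) ⟩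
    sum (λ j → sum λ t → A r t * (y j * M j t s))    ≈⟨ sum-cong-≋ (λ j → sum-cong-≋ λ t → x∙yz≈y∙xz (A r t) (y j) (M j t s)) ⟩
    sum (λ j → sum λ t → y j * (A r t * M j t s))    ≈⟨ sum-cong-≋ (λ j → *-distribˡ-sum (y j) λ t → A r t * M j t s) ⟨
    sum (λ j → y j * (A ⊗ M j) r s)                  ∎

  lincomb-⊗-lincomb : ∀ {k n} (x y : Vector k) (M : Fin k → Mat n) r s →
    (lincomb x M ⊗ lincomb y M) r s ≈ x · λ i → y · λ j → (M i ⊗ M j) r s
  lincomb-⊗-lincomb x y M r s =
    trans (lincomb-⊗ˡ x M (lincomb y M) r s) (·-cong (λ _ → refl) λ i → lincomb-⊗ʳ (M i) y M r s)

  [lincomb,lincomb] : ∀ {k n} (x y : Vector k) (M : Fin k → Mat n) r s →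
    [ lincomb x M , lincomb y M ] r s ≈ y · λ j → x · λ i → [ M i , M j ] r s
  [lincomb,lincomb] x y M r s = begin
    (lincomb x M ⊗ lincomb y M) r s - (lincomb y M ⊗ lincomb x M) r s
      ≈⟨ //-cong₂ (trans (lincomb-⊗-lincomb x y M r s) (·-swap x y P)) (lincomb-⊗-lincomb y x M r s) ⟩
    y · (λ j → x · λ i → P i j) - y · (λ j → x · P j)
      ≈⟨ ·-distribˡ-‿ y (λ j → x · λ i → P i j) (λ j → x · P j) ⟨
    y · (λ j → x · (λ i → P i j) - x · P j)
      ≈⟨ ·-cong (λ _ → refl) (λ j → ·-distribˡ-‿ x (λ i → P i j) (P j)) ⟨
    y · (λ j → x · λ i → [ M i , M j ] r s)  ∎
    where
    P : Fin _ → Fin _ → Carrier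
    P i j = (M i ⊗ M j) r s

  module _ {n k} (As : Fin k → Mat n) (S : List Carrier) {i₀ j₀ : Fin k} {r s : Fin n}
           (noncommuting : ¬ (As i₀ ⊗ As j₀) r s ≈ (As j₀ ⊗ As i₀) r s) where
    open SetoidMembership setoid using (_∈_)
    open SetoidMembershipProps using (index-injective)

    m : ℕ
    m = length S

    form : Vector k → Vector k
    form α j = α · λ i → [ As i , As j ] r s

    CommutingPair : Vector k × Vector k → Set (c ⊔ ℓ)
    CommutingPair (α , β) = ((∀ i → α i ∈ S) × (∀ i → β i ∈ S)) × Commute (lincomb α As) (lincomb β As)

    Split : Vector k × Vector k → Set ℓ
    Split (α , _) = Dec (form α j₀ ≈ 0#)

    commute⇒form≈0 : ∀ {α β} → Commute (lincomb α As) (lincomb β As) → β · form α ≈ 0#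
    commute⇒form≈0 {α} {β} AB≋BA = trans (sym ([lincomb,lincomb] α β As r s)) (Commute⇒[,]≈0 AB≋BA r s)

    indices : ∀ {α : Vector k} → (∀ i → α i ∈ S) → Fin k → Fin m
    indices α∈S i = index (α∈S i)

    code : ∀ {x} → CommutingPair x × Split x → Fin m → Fin (2 N.* (m N.^ k N.* m N.^ k))
    code (((α∈S , β∈S) , _) , no _)  b = encode (zero , indices α∈S , updateAt (indices β∈S) j₀ (const b))
    code (((α∈S , β∈S) , _) , yes _) b = encode (suc zero , updateAt (indices α∈S) i₀ (const b) , indices β∈S)

    [Aᵢ₀,Aⱼ₀]≉0 : ¬ [ As i₀ , As j₀ ] r s ≈ 0#
    [Aᵢ₀,Aⱼ₀]≉0 = noncommuting ∘ [,]≈0⇒commuteAt {A = As i₀} {As j₀}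

    form-cong : ∀ {α α'} → α ≈ᵥ α' → form α ≈ᵥ form α'
    form-cong α≈α' j = ·-cong α≈α' λ _ → refl

    code-injective : ∀ {x y} (qx : CommutingPair x × Split x) (qy : CommutingPair y × Split y) {b c} →
      code qx b ≡ code qy c → Setoid._≈_ (CoeffPairSetoid k) x y × b ≡ c
    code-injective {α , β} {α' , β'} (((α∈S , β∈S) , αβ) , no form≉0) (((α'∈S , β'∈S) , α'β') , no _) e
      with _ , α≡α' , β≡β' ← encode-injective e
      with b≡c , β≡β'-off ← updateAt-const-injective β≡β' =
      (α≈α' , ·-zero-unique form≉0 β≈β'-off (commute⇒form≈0 αβ) β'·form-α≈0) , b≡c
      where
      α≈α' : α ≈ᵥ α'
      α≈α' i = index-injective setoid (α∈S i) (α'∈S i) (α≡α' i)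
      β≈β'-off : AgreeOff j₀ β β'
      β≈β'-off i i≢j₀ = index-injective setoid (β∈S i) (β'∈S i) (β≡β'-off i i≢j₀)
      β'·form-α≈0 : β' · form α ≈ 0#
      β'·form-α≈0 = trans (·-cong (λ _ → refl) (form-cong α≈α')) (commute⇒form≈0 α'β')
    code-injective {α , β} {α' , β'} (((α∈S , β∈S) , _) , yes form≈0) (((α'∈S , β'∈S) , _) , yes form'≈0) e
      with _ , α≡α' , β≡β' ← encode-injective e
      with b≡c , α≡α'-off ← updateAt-const-injective α≡α' =
      (·-zero-unique [Aᵢ₀,Aⱼ₀]≉0 α≈α'-off form≈0 form'≈0 , β≈β') , b≡c
      where
      α≈α'-off : AgreeOff i₀ α α'
      α≈α'-off i i≢i₀ = index-injective setoid (α∈S i) (α'∈S i) (α≡α'-off i i≢i₀)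
      β≈β' : β ≈ᵥ β'
      β≈β' i = index-injective setoid (β∈S i) (β'∈S i) (β≡β' i)
    code-injective (_ , no _)  (_ , yes _) e = contradiction (proj₁ (encode-injective e)) λ ()
    code-injective (_ , yes _) (_ , no _)  e = contradiction (proj₁ (encode-injective e)) λ ()

    commuting-pairs-bound : ∀ {P} → SetoidUnique.Unique (CoeffPairSetoid k) P → All CommutingPair P → All Split P →
      length P N.* m N.≤ 2 N.* m N.^ (2 N.* k)
    commuting-pairs-bound {P} unique commuting splits =
      ≡.subst (λ N → length P N.* m N.≤ 2 N.* N) (m^k*m^k≡m^[2*k] m k)
        (unique-coding⇒≤ (CoeffPairSetoid k) unique (All.zip (commuting , splits)) code code-injective)

-- Field equality is not decidable, so the entry (r, s) at which Aᵢ and Aⱼ fail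
-- to commute, and the case split of every pair in P, exist only under double
-- negation; the conclusion is a decidable inequality of naturals, hence stable.
-- Distinctness of S is not needed: values are coded by their first index in S.
lemma1p4 : ∀ {c ℓ} (F : Field c ℓ) → let open FieldMat F in
    (n k : ℕ) (As : Fin k → Mat n) (S : List Carrier) →
    SetoidUnique.Unique setoid S →
    (∃₂ λ i j → ¬ Commute (As i) (As j)) →
    (P : List ((Fin k → Carrier) × (Fin k → Carrier))) →
    SetoidUnique.Unique (CoeffPairSetoid k) P →
    All (λ { (α , β) → ((∀ i → SetoidMembership._∈_ setoid (α i) S) × (∀ i → SetoidMembership._∈_ setoid (β i) S)) × Commute (lincomb α As) (lincomb β As) }) P →
    (length P N.* length S) N.≤ (2 N.* (length S N.^ (2 N.* k)))
lemma1p4 F n k As S _ (i₀ , j₀ , ¬commute) P unique commuting =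
  decidable-stable (_ ≤? _) λ ¬bound →
  ¬∀⇒¬¬∃¬ ¬commute λ (r , ¬commuteAtRow) →
  ¬∀⇒¬¬∃¬ ¬commuteAtRow λ (s , ¬commuteAt) →
  ¬¬-All (λ _ → ¬¬-excluded-middle) P λ splits →
  ¬bound (commuting-pairs-bound F As S ¬commuteAt unique (All.map (λ { {_ , _} q → q }) commuting) splits)
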